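{- Let $\mathcal{C}$ be a cartesian monoidal category (monoidal product $\times$, unit a terminal object $1$), and let $X,Y$ be $\mathbb{N}$-indexed families of objects of $\mathcal{C}$. Then $$\mathrm{Comb}_\infty(X,Y)\cong\prod_{n=0}^{\infty}\mathcal{C}(X_0\times\dots\times X_n,\,Y_n).$$
   Context: For families $X,Y$ define the coend in sets $\mathrm{Comb}_n^{+}(X,Y)=\int^{M_0,\dots,M_n\in\mathcal{C}}\prod_{i=0}^{n}\mathcal{C}(M_{i-1}\times X_i,\,M_i\times Y_i)$ with $M_{ -1}:=1$; its elements are classes $[f_0,\dots,f_n]$ of tuples of morphisms $f_i\colon M_{i-1}\times X_i\to M_i\times Y_i$ modulo the dinaturality (sliding of morphisms between memory objects) relation. Forgetting the last component gives well-defined projections $\mathrm{Comb}_{n+1}^+(X,Y)\to\mathrm{Comb}_n^+(X,Y)$, and $\mathrm{Comb}_\infty(X,Y):=\varprojlim_n\mathrm{Comb}_n^+(X,Y)$ along these projections. -}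

module Defs where

open import Level using (Level; _⊔_; suc)
open import Data.Nat using (ℕ; zero) renaming (suc to succ)
open import Data.Product using (Σ; _,_)
open import Relation.Binary.Core using (Rel)
open import Relation.Binary.Bundles using (Setoid)
open import Relation.Binary.Structures using (IsEquivalence)
open import Relation.Binary.Construct.Closure.Equivalence as EC using (EqClosure)

record Category (o ℓ e : Level) : Set (suc (o ⊔ ℓ ⊔ e)) where
  infixr 9 _∘_
  infix  4 _≈_
  infix  5 _⇒_
  field
    Obj : Set o
    _⇒_ : Obj → Obj → Set ℓ
    _≈_ : ∀ {A B} → Rel (A ⇒ B) e
    id  : ∀ {A} → A ⇒ A
    _∘_ : ∀ {A B C} → B ⇒ C → A ⇒ B → A ⇒ C
    equiv     : ∀ {A B} → IsEquivalence (_≈_ {A} {B})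
    assoc     : ∀ {A B C D} {f : A ⇒ B} {g : B ⇒ C} {h : C ⇒ D} →
                (h ∘ g) ∘ f ≈ h ∘ (g ∘ f)
    identityˡ : ∀ {A B} {f : A ⇒ B} → id ∘ f ≈ f
    identityʳ : ∀ {A B} {f : A ⇒ B} → f ∘ id ≈ f
    ∘-resp-≈  : ∀ {A B C} {f h : B ⇒ C} {g i : A ⇒ B} →
                f ≈ h → g ≈ i → f ∘ g ≈ h ∘ i

  hom-setoid : Obj → Obj → Setoid ℓ e
  hom-setoid A B = record { Carrier = A ⇒ B ; _≈_ = _≈_ ; isEquivalence = equiv }

record Cartesian {o ℓ e} (𝒞 : Category o ℓ e) : Set (o ⊔ ℓ ⊔ e) where
  open Category 𝒞
  infixr 7 _×_
  field
    ⊤        : Obj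
    !        : ∀ {A} → A ⇒ ⊤
    !-unique : ∀ {A} (f : A ⇒ ⊤) → ! ≈ f
    _×_      : Obj → Obj → Obj
    π₁       : ∀ {A B} → A × B ⇒ A
    π₂       : ∀ {A B} → A × B ⇒ B
    ⟨_,_⟩    : ∀ {A B C} → C ⇒ A → C ⇒ B → C ⇒ A × B
    project₁ : ∀ {A B C} {f : C ⇒ A} {g : C ⇒ B} → π₁ ∘ ⟨ f , g ⟩ ≈ f
    project₂ : ∀ {A B C} {f : C ⇒ A} {g : C ⇒ B} → π₂ ∘ ⟨ f , g ⟩ ≈ g
    unique   : ∀ {A B C} {f : C ⇒ A} {g : C ⇒ B} {h : C ⇒ A × B} →
               π₁ ∘ h ≈ f → π₂ ∘ h ≈ g → ⟨ f , g ⟩ ≈ h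

  infixr 8 _⊗₁_
  _⊗₁_ : ∀ {A B C D} → A ⇒ B → C ⇒ D → A × C ⇒ B × D
  f ⊗₁ g = ⟨ f ∘ π₁ , g ∘ π₂ ⟩

record CartesianCategory (o ℓ e : Level) : Set (suc (o ⊔ ℓ ⊔ e)) where
  field
    category  : Category o ℓ e
    cartesian : Cartesian category
  open Category category public
  open Cartesian cartesian public

module Combs {o ℓ e} (𝒞 : CartesianCategory o ℓ e)
             (X Y : ℕ → CartesianCategory.Obj 𝒞) where
  open CartesianCategory 𝒞

  -- Tuple n k A : tuples (f_k , … , f_{k+n}) with incoming memory A = M_{k-1},
  -- f_i : M_{i-1} × X i ⇒ M_i × Y i, together with the memory objects M_i.
  data Tuple : ℕ → ℕ → Obj → Set (o ⊔ ℓ) where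
    last : ∀ {k A} (M : Obj) → A × X k ⇒ M × Y k → Tuple zero k A
    cons : ∀ {n k A} (M : Obj) → A × X k ⇒ M × Y k →
           Tuple n (succ k) M → Tuple (succ n) k A

  precomp : ∀ {n k A A'} → A' ⇒ A → Tuple n k A → Tuple n k A'
  precomp h (last M f)   = last M (f ∘ (h ⊗₁ id))
  precomp h (cons M f t) = cons M (f ∘ (h ⊗₁ id)) t

  -- generating relation of the coend: componentwise equality of morphisms
  -- and dinaturality (sliding a morphism h : M_i ⇒ M_i' between memories)
  data Step : ∀ {n k A} → Rel (Tuple n k A) (o ⊔ ℓ ⊔ e) where
    last-≈     : ∀ {k A M} {f g : A × X k ⇒ M × Y k} →
                 f ≈ g → Step (last M f) (last M g)
    cons-≈     : ∀ {n k A M} {f g : A × X k ⇒ M × Y k} {t : Tuple n (succ k) M} →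
                 f ≈ g → Step (cons M f t) (cons M g t)
    cons-tail  : ∀ {n k A M} {f : A × X k ⇒ M × Y k} {t t' : Tuple n (succ k) M} →
                 Step t t' → Step (cons M f t) (cons M f t')
    slide-last : ∀ {k A M M'} (h : M ⇒ M') (f : A × X k ⇒ M × Y k) →
                 Step (last M' ((h ⊗₁ id) ∘ f)) (last M f)
    slide-cons : ∀ {n k A M M'} (h : M ⇒ M') (f : A × X k ⇒ M × Y k)
                 (t : Tuple n (succ k) M') →
                 Step (cons M' ((h ⊗₁ id) ∘ f) t) (cons M f (precomp h t))

  -- Comb⁺_n(X,Y) as a setoid (the coend in sets, presented as a quotient)
  Comb⁺ : ℕ → Setoid (o ⊔ ℓ) (o ⊔ ℓ ⊔ e)
  Comb⁺ n = EC.setoid (Step {n} {0} {⊤})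

  proj : ∀ {n k A} → Tuple (succ n) k A → Tuple n k A
  proj {zero}   (cons M f t) = last M f
  proj {succ n} (cons M f t) = cons M f (proj t)

  -- Comb_∞(X,Y) = inverse limit of the Comb⁺_n along proj
  Comb∞ : Setoid (o ⊔ ℓ ⊔ e) (o ⊔ ℓ ⊔ e)
  Comb∞ = record
    { Carrier = Σ ((n : ℕ) → Tuple n 0 ⊤)
                  (λ c → (n : ℕ) → EqClosure Step (proj (c (succ n))) (c n))
    ; _≈_ = λ { (c , _) (d , _) → (n : ℕ) → EqClosure Step (c n) (d n) }
    ; isEquivalence = record
      { refl  = λ n → EC.reflexive Step
      ; sym   = λ p n → EC.symmetric Step (p n)
      ; trans = λ p q n → EC.transitive Step (p n) (q n)
      }
    }

  prefix : ℕ → Obj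
  prefix zero     = X zero
  prefix (succ n) = prefix n × X (succ n)

  ProdHom : Setoid ℓ e
  ProdHom = record
    { Carrier = (n : ℕ) → prefix n ⇒ Y n
    ; _≈_ = λ f g → (n : ℕ) → f n ≈ g n
    ; isEquivalence = record
      { refl  = λ n → IsEquivalence.refl equiv
      ; sym   = λ p n → IsEquivalence.sym equiv (p n)
      ; trans = λ p q n → IsEquivalence.trans equiv (p n) (q n)
      }
    }

module Submission where

-- Write Hist k = 1 × X₀ × … × X_{k-1} for the object of histories before step k;
-- X₀ × … × Xₙ ≅ Hist (n+1).  A tuple (f_k, …) started in a memory s : Hist k ⇒ A,
-- given as a function of the history, can be *run*: each stage f_i ∘ (s ⊗ id)
-- yields the next memory (first projection) and the output (second projection).
-- The output of the last stage is invariant under the coend relation, which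
-- gives the map Comb∞ → ∏ₙ.  Conversely a family G_j : Hist (j+1) ⇒ Y_j is
-- realised by the canonical tuple with memory M_j = Hist (j+1) and components
-- f_j = ⟨ id , G_j ⟩ (remember everything, output G_j); running it returns G.
-- The heart of the proof is the normal form: if every stage of a tuple outputs
-- G, sliding each memory map s_j through the tuple turns it into the canonical
-- tuple of G.  For an element of the limit, every stage's output is the output
-- of one of its truncations, so the compatibility condition puts it in normal form.

open import Defs
open import Data.Nat using (ℕ; zero; _+_) renaming (suc to succ)
open import Data.Nat.Properties using (+-suc; +-identityʳ)
open import Data.Product using (_,_; proj₁; proj₂) renaming (_×_ to _∧_)
open import Function.Bundles using (Inverse; _⇔_; mk⇔; module Equivalence)
open import Function.Properties.Equivalence using () renaming (trans to ⇔-trans)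
open import Relation.Binary.Core using (Rel)
open import Relation.Binary.Bundles using (Setoid)
open import Relation.Binary.Structures using (IsEquivalence)
open import Level using (_⊔_)
open import Relation.Binary.PropositionalEquality using (_≡_; refl; subst; trans; cong)
open import Relation.Binary.Construct.Closure.Equivalence as EC using (EqClosure)
open import Relation.Binary.Construct.Closure.ReflexiveTransitive using (_◅◅_)
import Relation.Binary.Reasoning.Setoid as SetoidReasoning

-- Tail-recursive addition: m ⊕ k is the index of the last component of a tuple of
-- length m+1 starting at k.  The clause succ m ⊕ k = m ⊕ succ k mirrors 'cons',
-- so running a tuple needs no transport along index equations.
infixl 6 _⊕_
_⊕_ : ℕ → ℕ → ℕ
zero   ⊕ k = k
succ m ⊕ k = m ⊕ succ k

⊕≡+ : ∀ m k → m ⊕ k ≡ m + k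
⊕≡+ zero     k = refl
⊕≡+ (succ m) k = trans (⊕≡+ m (succ k)) (+-suc m k)

⊕-identityʳ : ∀ m → m ⊕ 0 ≡ m
⊕-identityʳ m = trans (⊕≡+ m 0) (+-identityʳ m)

module CartesianLemmas {o ℓ e} (𝒞 : CartesianCategory o ℓ e) where
  open CartesianCategory 𝒞

  module Hom {A B : Obj} = IsEquivalence (equiv {A} {B})

  ∘-congˡ : ∀ {A B C} {h : B ⇒ C} {f g : A ⇒ B} → f ≈ g → h ∘ f ≈ h ∘ g
  ∘-congˡ p = ∘-resp-≈ Hom.refl p

  ∘-congʳ : ∀ {A B C} {h : A ⇒ B} {f g : B ⇒ C} → f ≈ g → f ∘ h ≈ g ∘ h
  ∘-congʳ p = ∘-resp-≈ p Hom.refl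

  ⟨⟩-cong : ∀ {A B C} {f f' : C ⇒ A} {g g' : C ⇒ B} →
            f ≈ f' → g ≈ g' → ⟨ f , g ⟩ ≈ ⟨ f' , g' ⟩
  ⟨⟩-cong p q = unique (Hom.trans project₁ (Hom.sym p)) (Hom.trans project₂ (Hom.sym q))

  ⟨⟩-η : ∀ {A B C} {h : C ⇒ A × B} → ⟨ π₁ ∘ h , π₂ ∘ h ⟩ ≈ h
  ⟨⟩-η = unique Hom.refl Hom.refl

  ⟨π₁,π₂⟩≈id : ∀ {A B} → ⟨ π₁ , π₂ ⟩ ≈ id {A × B}
  ⟨π₁,π₂⟩≈id = unique identityʳ identityʳ

  ⟨⟩∘ : ∀ {A B C D} {f : C ⇒ A} {g : C ⇒ B} {h : D ⇒ C} →
        ⟨ f , g ⟩ ∘ h ≈ ⟨ f ∘ h , g ∘ h ⟩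
  ⟨⟩∘ = Hom.sym (unique (Hom.trans (Hom.sym assoc) (∘-congʳ project₁))
                        (Hom.trans (Hom.sym assoc) (∘-congʳ project₂)))

  ⊗₁∘⟨⟩ : ∀ {A B C D E} {f : A ⇒ B} {g : C ⇒ D} {a : E ⇒ A} {b : E ⇒ C} →
          (f ⊗₁ g) ∘ ⟨ a , b ⟩ ≈ ⟨ f ∘ a , g ∘ b ⟩
  ⊗₁∘⟨⟩ = Hom.trans ⟨⟩∘ (⟨⟩-cong (Hom.trans assoc (∘-congˡ project₁))
                                 (Hom.trans assoc (∘-congˡ project₂)))

  ⊗₁-cong : ∀ {A B C D} {f f' : A ⇒ B} {g g' : C ⇒ D} →
            f ≈ f' → g ≈ g' → f ⊗₁ g ≈ f' ⊗₁ g'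
  ⊗₁-cong p q = ⟨⟩-cong (∘-congʳ p) (∘-congʳ q)

  ⊗₁-∘ : ∀ {A B C D E F} {f : B ⇒ C} {g : E ⇒ F} {h : A ⇒ B} {k : D ⇒ E} →
         (f ⊗₁ g) ∘ (h ⊗₁ k) ≈ (f ∘ h) ⊗₁ (g ∘ k)
  ⊗₁-∘ = Hom.trans ⊗₁∘⟨⟩ (⟨⟩-cong (Hom.sym assoc) (Hom.sym assoc))

  ⊗₁-id : ∀ {A B} → id ⊗₁ id ≈ id {A × B}
  ⊗₁-id = Hom.trans (⟨⟩-cong identityˡ identityˡ) ⟨π₁,π₂⟩≈id

  ⊗₁id-inverse : ∀ {A B C} {f : A ⇒ B} {g : B ⇒ A} →
                 g ∘ f ≈ id → (g ⊗₁ id {C}) ∘ (f ⊗₁ id) ≈ id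
  ⊗₁id-inverse p = Hom.trans ⊗₁-∘ (Hom.trans (⊗₁-cong p identityˡ) ⊗₁-id)

  ⊗₁id-∘ : ∀ {A B C D} {h : B ⇒ C} {s : A ⇒ B} →
           (h ⊗₁ id {D}) ∘ (s ⊗₁ id) ≈ (h ∘ s) ⊗₁ id
  ⊗₁id-∘ = Hom.trans ⊗₁-∘ (⊗₁-cong Hom.refl identityˡ)

  ∘⊗₁id-unit : ∀ {A B C} {u : A × C ⇒ B} {s : A ⇒ A} → s ≈ id → u ∘ (s ⊗₁ id) ≈ u
  ∘⊗₁id-unit p = Hom.trans (∘-congˡ (Hom.trans (⊗₁-cong p Hom.refl) ⊗₁-id)) identityʳ

  π₁∘⊗₁id : ∀ {A B C D} {h : B ⇒ C} {u : A ⇒ B × D} →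
            π₁ ∘ ((h ⊗₁ id {D}) ∘ u) ≈ h ∘ (π₁ ∘ u)
  π₁∘⊗₁id = Hom.trans (Hom.sym assoc) (Hom.trans (∘-congʳ project₁) assoc)

  π₂∘⊗₁id : ∀ {A B C D} {h : B ⇒ C} {u : A ⇒ B × D} →
            π₂ ∘ ((h ⊗₁ id {D}) ∘ u) ≈ π₂ ∘ u
  π₂∘⊗₁id = Hom.trans (Hom.sym assoc)
              (∘-congʳ (Hom.trans project₂ identityˡ))

  copy-factorisation : ∀ {A M Y} {u : A ⇒ M × Y} {b : A ⇒ Y} →
                       π₂ ∘ u ≈ b → u ≈ ((π₁ ∘ u) ⊗₁ id) ∘ ⟨ id , b ⟩
  copy-factorisation {u = u} {b} p = Hom.sym (begin
      ((π₁ ∘ u) ⊗₁ id) ∘ ⟨ id , b ⟩  ≈⟨ ⊗₁∘⟨⟩ ⟩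
      ⟨ (π₁ ∘ u) ∘ id , id ∘ b ⟩     ≈⟨ ⟨⟩-cong identityʳ (Hom.trans identityˡ (Hom.sym p)) ⟩
      ⟨ π₁ ∘ u , π₂ ∘ u ⟩            ≈⟨ ⟨⟩-η ⟩
      u                              ∎)
    where open SetoidReasoning (hom-setoid _ _)

  ⟨!,id⟩∘π₂ : ∀ {A} → ⟨ ! , id ⟩ ∘ π₂ ≈ id {⊤ × A}
  ⟨!,id⟩∘π₂ = begin
      ⟨ ! , id ⟩ ∘ π₂       ≈⟨ ⟨⟩∘ ⟩
      ⟨ ! ∘ π₂ , id ∘ π₂ ⟩  ≈⟨ ⟨⟩-cong (Hom.trans (Hom.sym (!-unique _)) (!-unique π₁)) identityˡ ⟩
      ⟨ π₁ , π₂ ⟩           ≈⟨ ⟨π₁,π₂⟩≈id ⟩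
      id                    ∎
    where open SetoidReasoning (hom-setoid _ _)

  transpose : ∀ {A B C} {i : A ⇒ B} {r : B ⇒ A} {u : B ⇒ C} {v : A ⇒ C} →
              i ∘ r ≈ id → r ∘ i ≈ id → (u ≈ v ∘ r) ⇔ (u ∘ i ≈ v)
  transpose {i = i} {r} {u} {v} ir ri = mk⇔ move-left move-right
    where
    move-right : u ∘ i ≈ v → u ≈ v ∘ r
    move-right p = begin
       u              ≈⟨ Hom.sym identityʳ ⟩
       u ∘ id         ≈⟨ ∘-congˡ (Hom.sym ir) ⟩
       u ∘ (i ∘ r)    ≈⟨ Hom.sym assoc ⟩
       (u ∘ i) ∘ r    ≈⟨ ∘-congʳ p ⟩
       v ∘ r          ∎
      where open SetoidReasoning (hom-setoid _ _)
    move-left : u ≈ v ∘ r → u ∘ i ≈ v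
    move-left p = begin
       u ∘ i          ≈⟨ ∘-congʳ p ⟩
       (v ∘ r) ∘ i    ≈⟨ assoc ⟩
       v ∘ (r ∘ i)    ≈⟨ ∘-congˡ ri ⟩
       v ∘ id         ≈⟨ identityʳ ⟩
       v              ∎
      where open SetoidReasoning (hom-setoid _ _)

module CombAnalysis {o ℓ e} (𝒞 : CartesianCategory o ℓ e)
                    (X Y : ℕ → CartesianCategory.Obj 𝒞) where
  open CartesianCategory 𝒞
  open CartesianLemmas 𝒞
  open Combs 𝒞 X Y

  infix 4 _~_
  _~_ : ∀ {n k A} → Rel (Tuple n k A) (o ⊔ ℓ ⊔ e)
  _~_ = EqClosure Step

  ≡⇒~ : ∀ {n k A} {t t' : Tuple n k A} → t ≡ t' → t ~ t'
  ≡⇒~ = Setoid.reflexive (EC.setoid Step)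

  Hist : ℕ → Obj
  Hist zero     = ⊤
  Hist (succ k) = Hist k × X k

  toHist : ∀ n → prefix n ⇒ Hist (succ n)
  toHist zero     = ⟨ ! , id ⟩
  toHist (succ n) = toHist n ⊗₁ id

  fromHist : ∀ n → Hist (succ n) ⇒ prefix n
  fromHist zero     = π₂
  fromHist (succ n) = fromHist n ⊗₁ id

  fromHist∘toHist : ∀ n → fromHist n ∘ toHist n ≈ id
  fromHist∘toHist zero     = project₂
  fromHist∘toHist (succ n) = ⊗₁id-inverse (fromHist∘toHist n)

  toHist∘fromHist : ∀ n → toHist n ∘ fromHist n ≈ id
  toHist∘fromHist zero     = ⟨!,id⟩∘π₂
  toHist∘fromHist (succ n) = ⊗₁id-inverse (toHist∘fromHist n)

  Strategy : Set ℓ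
  Strategy = (j : ℕ) → Hist (succ j) ⇒ Y j

  stage : ∀ {k A M} → A × X k ⇒ M × Y k → Hist k ⇒ A → Hist (succ k) ⇒ M × Y k
  stage f s = f ∘ (s ⊗₁ id)

  stage-cong : ∀ {k A M} {f : A × X k ⇒ M × Y k} {s s' : Hist k ⇒ A} →
               s ≈ s' → stage f s ≈ stage f s'
  stage-cong p = ∘-congˡ (⊗₁-cong p Hom.refl)

  stage-precomp : ∀ {k A A' M} {f : A × X k ⇒ M × Y k} {h : A' ⇒ A} {s : Hist k ⇒ A'} →
                  stage (f ∘ (h ⊗₁ id)) s ≈ stage f (h ∘ s)
  stage-precomp = Hom.trans assoc (∘-congˡ ⊗₁id-∘)

  run : ∀ {m k A} → Tuple m k A → Hist k ⇒ A → Hist (succ (m ⊕ k)) ⇒ Y (m ⊕ k)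
  run (last M f)   s = π₂ ∘ stage f s
  run (cons M f t) s = run t (π₁ ∘ stage f s)

  run-cong : ∀ {m k A} (t : Tuple m k A) {s s' : Hist k ⇒ A} → s ≈ s' → run t s ≈ run t s'
  run-cong (last M f)   p = ∘-congˡ (stage-cong p)
  run-cong (cons M f t) p = run-cong t (∘-congˡ (stage-cong p))

  run-precomp : ∀ {m k A A'} (t : Tuple m k A) {h : A' ⇒ A} {s : Hist k ⇒ A'} →
                run (precomp h t) s ≈ run t (h ∘ s)
  run-precomp (last M f)   = ∘-congˡ stage-precomp
  run-precomp (cons M f t) = run-cong t (∘-congˡ stage-precomp)

  run-step : ∀ {m k A} {t t' : Tuple m k A} {s : Hist k ⇒ A} → Step t t' → run t s ≈ run t' s
  run-step (last-≈ p)            = ∘-congˡ (∘-congʳ p)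
  run-step (cons-≈ {t = t} p)    = run-cong t (∘-congˡ (∘-congʳ p))
  run-step (cons-tail p)         = run-step p
  run-step (slide-last h f)      = Hom.trans (∘-congˡ assoc) π₂∘⊗₁id
  run-step (slide-cons h f t)    =
    Hom.trans (run-cong t (Hom.trans (∘-congˡ assoc) π₁∘⊗₁id)) (Hom.sym (run-precomp t))

  run-resp : ∀ {m k A} {t t' : Tuple m k A} {s : Hist k ⇒ A} → t ~ t' → run t s ≈ run t' s
  run-resp {s = s} = EC.gfold equiv (λ t → run t s) run-step

  proj-precomp : ∀ {n k A A'} (h : A' ⇒ A) (t : Tuple (succ n) k A) →
                 proj (precomp h t) ≡ precomp h (proj t)
  proj-precomp {zero}   h (cons M f t) = refl
  proj-precomp {succ n} h (cons M f t) = refl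

  cons-resp : ∀ {n k A M} {f : A × X k ⇒ M × Y k} {t t' : Tuple n (succ k) M} →
              t ~ t' → cons M f t ~ cons M f t'
  cons-resp {M = M} {f} = EC.gmap (cons M f) cons-tail

  proj-step : ∀ {n k A} {t t' : Tuple (succ n) k A} → Step t t' → proj t ~ proj t'
  proj-step {zero}   (cons-≈ p)         = EC.return (last-≈ p)
  proj-step {succ n} (cons-≈ p)         = EC.return (cons-≈ p)
  proj-step {zero}   (cons-tail p)      = EC.reflexive Step
  proj-step {succ n} (cons-tail p)      = cons-resp (proj-step p)
  proj-step {zero}   (slide-cons h f t) = EC.return (slide-last h f)
  proj-step {succ n} (slide-cons h f t)
    rewrite proj-precomp h t            = EC.return (slide-cons h f (proj t))

  proj-resp : ∀ {n k A} {t t' : Tuple (succ n) k A} → t ~ t' → proj t ~ proj t'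
  proj-resp = EC.gfold (EC.isEquivalence Step) proj proj-step

  canonical : Strategy → ∀ m k → Tuple m k (Hist k)
  canonical G zero     k = last (Hist (succ k)) ⟨ id , G k ⟩
  canonical G (succ m) k = cons (Hist (succ k)) ⟨ id , G k ⟩ (canonical G m (succ k))

  proj-canonical : ∀ G m k → proj (canonical G (succ m) k) ≡ canonical G m k
  proj-canonical G zero     k = refl
  proj-canonical G (succ m) k = cong (cons _ _) (proj-canonical G m (succ k))

  canonical-cong : ∀ {G G'} → (∀ j → G j ≈ G' j) → ∀ m k → canonical G m k ~ canonical G' m k
  canonical-cong p zero     k = EC.return (last-≈ (⟨⟩-cong Hom.refl (p k)))
  canonical-cong p (succ m) k =
    EC.return (cons-≈ (⟨⟩-cong Hom.refl (p k))) ◅◅ cons-resp (canonical-cong p m (succ k))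

  run-canonical : ∀ G m k {s : Hist k ⇒ Hist k} → s ≈ id → run (canonical G m k) s ≈ G (m ⊕ k)
  run-canonical G zero     k p = Hom.trans (∘-congˡ (∘⊗₁id-unit p)) project₂
  run-canonical G (succ m) k p =
    run-canonical G m (succ k) (Hom.trans (∘-congˡ (∘⊗₁id-unit p)) project₁)

  Agree : Strategy → ∀ {m k A} → Tuple m k A → Hist k ⇒ A → Set e
  Agree G {k = k} (last M f)   s = π₂ ∘ stage f s ≈ G k
  Agree G {k = k} (cons M f t) s = (π₂ ∘ stage f s ≈ G k) ∧ Agree G t (π₁ ∘ stage f s)

  normalise : ∀ G {m k A} (t : Tuple m k A) (s : Hist k ⇒ A) →
              Agree G t s → precomp s t ~ canonical G m k
  normalise G {k = k} (last M f) s a =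
    EC.return (last-≈ (copy-factorisation a)) ◅◅
    EC.return (slide-last (π₁ ∘ stage f s) ⟨ id , G k ⟩)
  normalise G {k = k} (cons M f t) s (a , as) =
    EC.return (cons-≈ (copy-factorisation a)) ◅◅
    EC.return (slide-cons (π₁ ∘ stage f s) ⟨ id , G k ⟩ t) ◅◅
    cons-resp (normalise G t (π₁ ∘ stage f s) as)

  agree-snoc : ∀ G {m k A} (t : Tuple (succ m) k A) (s : Hist k ⇒ A) →
               Agree G (proj t) s → run t s ≈ G (succ m ⊕ k) → Agree G t s
  agree-snoc G {zero}   (cons M f (last M' f')) s a       r = a , r
  agree-snoc G {succ m} (cons M f t)            s (a , as) r = a , agree-snoc G t _ as r

  AgreeTrunc : Strategy → ∀ {m k A} → Tuple m k A → Hist k ⇒ A → Set e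
  AgreeTrunc G {zero}   t s = run t s ≈ G (zero ⊕ _)
  AgreeTrunc G {succ m} t s = (run t s ≈ G (succ m ⊕ _)) ∧ AgreeTrunc G (proj t) s

  -- unlike Agree, AgreeTrunc is visibly invariant under the coend relation
  agreeTrunc-resp : ∀ G {m k A} {t t' : Tuple m k A} {s : Hist k ⇒ A} →
                    t ~ t' → AgreeTrunc G t s → AgreeTrunc G t' s
  agreeTrunc-resp G {zero}   p r        = Hom.trans (Hom.sym (run-resp p)) r
  agreeTrunc-resp G {succ m} p (r , rs) =
    Hom.trans (Hom.sym (run-resp p)) r , agreeTrunc-resp G (proj-resp p) rs

  agreeTrunc⇒agree : ∀ G {m k A} (t : Tuple m k A) (s : Hist k ⇒ A) →
                     AgreeTrunc G t s → Agree G t s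
  agreeTrunc⇒agree G {zero}   (last M f) s r        = r
  agreeTrunc⇒agree G {succ m} t          s (r , rs) =
    agree-snoc G t s (agreeTrunc⇒agree G (proj t) s rs) r

  precomp-id : ∀ {m k A} (t : Tuple m k A) → t ~ precomp id t
  precomp-id (last M f)   = EC.return (last-≈ (Hom.sym (∘⊗₁id-unit Hom.refl)))
  precomp-id (cons M f t) = EC.return (cons-≈ (Hom.sym (∘⊗₁id-unit Hom.refl)))

module CombIsomorphism {o ℓ e} (𝒞 : CartesianCategory o ℓ e)
                       (X Y : ℕ → CartesianCategory.Obj 𝒞) where
  open CartesianCategory 𝒞
  open CartesianLemmas 𝒞
  open Combs 𝒞 X Y
  open CombAnalysis 𝒞 X Y

  Component : ℕ → Set ℓ
  Component n = prefix n ⇒ Y n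

  subst-cong : ∀ {a b} (q : a ≡ b) {u v : Component a} →
               u ≈ v → subst Component q u ≈ subst Component q v
  subst-cong refl p = p

  subst-over : ∀ (g : (j : ℕ) → Component j) {a b} (q : a ≡ b) {u : Component a} →
               (u ≈ g a) ⇔ (subst Component q u ≈ g b)
  subst-over g refl = mk⇔ (λ p → p) (λ p → p)

  histForm : ((n : ℕ) → Component n) → Strategy
  histForm g j = g j ∘ fromHist j

  output : ∀ {n} → Tuple n 0 ⊤ → Component n
  output {n} t = subst Component (⊕-identityʳ n) (run t id ∘ toHist (n ⊕ 0))

  output-resp : ∀ {n} {t t' : Tuple n 0 ⊤} → t ~ t' → output t ≈ output t'
  output-resp {n} p = subst-cong (⊕-identityʳ n) (∘-congʳ (run-resp p))

  output-spec : ∀ g {n} (t : Tuple n 0 ⊤) →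
                (run t id ≈ histForm g (n ⊕ 0)) ⇔ (output t ≈ g n)
  output-spec g {n} t =
    ⇔-trans (transpose (toHist∘fromHist (n ⊕ 0)) (fromHist∘toHist (n ⊕ 0)))
            (subst-over g (⊕-identityʳ n))

  Limit : Set (o ⊔ ℓ ⊔ e)
  Limit = Setoid.Carrier Comb∞

  toProd : Limit → (n : ℕ) → Component n
  toProd (c , _) n = output (c n)

  fromProd : ((n : ℕ) → Component n) → Limit
  fromProd g = (λ n → canonical (histForm g) n 0)
             , (λ n → ≡⇒~ (proj-canonical (histForm g) n 0))

  histForm-cong : ∀ {g g'} → (∀ n → g n ≈ g' n) → ∀ j → histForm g j ≈ histForm g' j
  histForm-cong p j = ∘-congʳ (p j)

  output-canonical : ∀ g n → output (canonical (histForm g) n 0) ≈ g n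
  output-canonical g n =
    Equivalence.to (output-spec g (canonical (histForm g) n 0))
                   (run-canonical (histForm g) n 0 Hom.refl)

  last-output : ∀ (c : Limit) n → run (proj₁ c n) id ≈ histForm (toProd c) (n ⊕ 0)
  last-output c n = Equivalence.from (output-spec (toProd c) (proj₁ c n)) Hom.refl

  -- by compatibility, every truncation of c n is equivalent to an earlier component of c
  limit-agreeTrunc : ∀ (c : Limit) n → AgreeTrunc (histForm (toProd c)) (proj₁ c n) id
  limit-agreeTrunc c zero     = last-output c zero
  limit-agreeTrunc c (succ n) =
    last-output c (succ n) ,
    agreeTrunc-resp (histForm (toProd c)) (EC.symmetric Step (proj₂ c n)) (limit-agreeTrunc c n)

  limit-normal : ∀ (c : Limit) n → proj₁ c n ~ canonical (histForm (toProd c)) n 0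
  limit-normal c n =
    precomp-id (proj₁ c n) ◅◅
    normalise G (proj₁ c n) id (agreeTrunc⇒agree G (proj₁ c n) id (limit-agreeTrunc c n))
    where
    G : Strategy
    G = histForm (toProd c)

mainTheorem4 : ∀ {o ℓ e} (𝒞 : CartesianCategory o ℓ e)
               (X Y : ℕ → CartesianCategory.Obj 𝒞) →
               Inverse (Combs.Comb∞ 𝒞 X Y) (Combs.ProdHom 𝒞 X Y)
mainTheorem4 𝒞 X Y = record
  { to        = toProd
  ; from      = fromProd
  ; to-cong   = λ p n → output-resp (p n)
  ; from-cong = λ p n → canonical-cong (histForm-cong p) n 0
  ; inverse   = (λ {g} p n → Hom.trans (output-resp (p n)) (output-canonical g n))
              , (λ {c} p n → canonical-cong (histForm-cong p) n 0 ◅◅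
                             EC.symmetric Step (limit-normal c n))
  }
  where
  open CartesianLemmas 𝒞 using (module Hom)
  open Combs 𝒞 X Y using (Step)
  open CombAnalysis 𝒞 X Y using (canonical-cong)
  open CombIsomorphism 𝒞 X Y
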